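{- For every $\varepsilon>0$ there is a finite digraph $D$ with $\vec{\chi}_c(D)-\vec{\chi}^\ast(D)\ge1-\varepsilon$.
   Context: A digraph is acyclic if it contains no directed cycle. For real $p\ge1$ identify $S_p=\mathbb{R}/p\mathbb{Z}$ with $[0,p)$, $x\bmod p$ the representative in $[0,p)$, $(a,b)_p:=\{y\in[0,p):0<(y-a)\bmod p<(b-a)\bmod p\}$ of length $(b-a)\bmod p$. An acyclic $p$-colouring of $D$ is $c:V(D)\to[0,p)$ such that for each open cyclic interval $I$ of length $1$, $c^{ -1}(I)$ induces an acyclic subdigraph; $\vec{\chi}^\ast(D)$ is the infimum of such $p\ge1$. A weak circular $p$-colouring of $D$ is $c:V(D)\to[0,p)$ such that for every arc $(u,w)$ either $c(u)=c(w)$ or $(c(w)-c(u))\bmod p\ge1$, and each $c^{ -1}(t)$ induces an acyclic subdigraph; $\vec{\chi}_c(D)$ is the infimum of such $p\ge1$.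
   Formalization: The parameter ε, the numbers p and the colours are rational instead of real, so $\vec{\chi}_c(D)$ and $\vec{\chi}^\ast(D)$ are infima taken within ℚ. -}

module Defs where

open import Data.Nat using (ℕ; suc)
open import Data.Fin using (Fin; zero; suc; inject₁; fromℕ)
open import Data.Bool using (Bool; true; false)
open import Data.Integer using (ℤ)
open import Data.Rational using (ℚ; 0ℚ; 1ℚ; _≤_; _<_; _+_; _-_; _*_; _/_)
open import Data.Product using (Σ; ∃; _×_; _,_)
open import Data.Sum using (_⊎_)
open import Relation.Nullary using (¬_)
open import Relation.Binary.PropositionalEquality using (_≡_)
open import Function.Definitions using (Injective)

record Digraph : Set where
  field
    n        : ℕ
    arc      : Fin n → Fin n → Bool
    loopless : ∀ v → arc v v ≡ false
open Digraph public

Vertex : Digraph → Set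
Vertex D = Fin (n D)

Arc : (D : Digraph) → Vertex D → Vertex D → Set
Arc D u w = arc D u w ≡ true

record DirectedCycleIn (D : Digraph) (X : Vertex D → Set) : Set where
  field
    k      : ℕ
    f      : Fin (suc k) → Vertex D
    inj    : Injective _≡_ _≡_ f
    inX    : ∀ i → X (f i)
    step   : ∀ (j : Fin k) → Arc D (f (inject₁ j)) (f (suc j))
    close  : Arc D (f (fromℕ k)) (f zero)

InducesAcyclic : (D : Digraph) → (Vertex D → Set) → Set
InducesAcyclic D X = ¬ DirectedCycleIn D X

IsMod : ℚ → ℚ → ℚ → Set
IsMod p x r = (0ℚ ≤ r) × (r < p) × ∃ λ (m : ℤ) → x ≡ r + (m / 1) * p

-- y lies in the open cyclic interval of length 1 starting at a (on S_p).
InUnitIntervalFrom : ℚ → ℚ → ℚ → Set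
InUnitIntervalFrom p a y = ∃ λ r → IsMod p (y - a) r × (0ℚ < r) × (r < 1ℚ)

Colouring : Digraph → ℚ → Set
Colouring D p = Σ (Vertex D → ℚ) λ c → ∀ v → (0ℚ ≤ c v) × (c v < p)

IsAcyclicColouring : (D : Digraph) (p : ℚ) → Colouring D p → Set
IsAcyclicColouring D p (c , _) =
  ∀ a → 0ℚ ≤ a → a < p → InducesAcyclic D (λ v → InUnitIntervalFrom p a (c v))

IsWeakCircularColouring : (D : Digraph) (p : ℚ) → Colouring D p → Set
IsWeakCircularColouring D p (c , _) =
  (∀ u w → Arc D u w →
     (c u ≡ c w) ⊎ (∃ λ r → IsMod p (c w - c u) r × (1ℚ ≤ r)))
  × (∀ t → InducesAcyclic D (λ v → c v ≡ t))

AcyclicColourable : Digraph → ℚ → Set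
AcyclicColourable D p = (1ℚ ≤ p) × Σ (Colouring D p) (IsAcyclicColouring D p)

WeakCircularColourable : Digraph → ℚ → Set
WeakCircularColourable D p = (1ℚ ≤ p) × Σ (Colouring D p) (IsWeakCircularColouring D p)

IsInfimum : (ℚ → Set) → ℚ → Set
IsInfimum S x = (∀ p → S p → x ≤ p)
              × (∀ δ → 0ℚ < δ → ∃ λ p → S p × (p < x + δ))

DichromaticStar : Digraph → ℚ → Set
DichromaticStar D = IsInfimum (AcyclicColourable D)

CircularDichromatic : Digraph → ℚ → Set
CircularDichromatic D = IsInfimum (WeakCircularColourable D)

-- The digraph is a directed cycle (the rim) on K = N + 1 vertices together with a sink
-- dominated by every rim vertex, so its only directed cycle is the rim.
--
-- For p < 2 measure every colour by its lead (c − s) mod p over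
-- the colour s of the sink.  The arcs into the sink force every rim lead to be at most
-- p − 1 < 1, and then a weak circular arc between rim vertices either keeps the colour or
-- lowers the lead.  Around the rim the lead cannot drop, so the rim is monochromatic, which
-- the acyclic colour classes forbid.  Colouring rim vertex 0 with 0 and everything else
-- with 1 shows p = 2 is attained.
--
-- For p = 1 + 1/N the rim colours i/N (0 ≤ i ≤ N) never fit in one open
-- unit arc of S_p.  Conversely, if no open unit arc holds all rim colours and p < 1 + 1/N,
-- pick a small θ > 0: behind every rim colour there is another one at distance in
-- [θ, θ + p − 1] on S_p.  Walking backwards, some rim vertex repeats within K steps, so a
-- positive multiple of p is at most K (θ + p − 1) < p.
--
-- Hence χ_c = 2 and χ* = 1 + 1/N, whose difference 1 − 1/N is at least 1 − ε once 1/N ≤ ε.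

module Submission where

open import Data.Empty using (⊥-elim)
open import Data.Fin as Fin using (Fin; zero; suc; inject₁; toℕ)
import Data.Fin.Properties as Fin
open import Data.Integer as ℤ using (ℤ)
import Data.Integer.Properties as ℤ
open import Data.List using (_∷_; [])
open import Data.Nat as ℕ using (ℕ)
import Data.Nat.DivMod as ℕ
import Data.Nat.Properties as ℕ
open import Data.Nat.Coprimality using (1-coprimeTo)
import Data.Nat.Coprimality as Coprime
open import Data.Product using (Σ; ∃; ∃₂; _×_; _,_; proj₁; proj₂)
open import Data.Rational
open import Data.Rational.Properties
open import Algebra.Properties.Group +-0-group using (inverseʳ-unique; x∙y⁻¹≈ε⇒x≈y)
open import Data.Sum using (_⊎_; inj₁; inj₂)
open import Function using (_∘_; _$_; flip)
open import Level using (0ℓ)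
open import Relation.Binary using (tri<; tri≈; tri>)
open import Relation.Binary.Definitions using (Reflexive; Transitive)
open import Relation.Binary.PropositionalEquality
open import Relation.Nullary using (¬_; Dec; yes; no; proof; Reflects; invert)
open import Relation.Nullary.Decidable
  using (dec⇒maybe; does; dec-true; dec-false; _×-dec_; _⊎-dec_; from-yes)
open import Relation.Nullary.Negation using (contradiction)
open import Tactic.RingSolver using (solve-∀; solve)
open import Tactic.RingSolver.Core.AlmostCommutativeRing
  using (AlmostCommutativeRing; fromCommutativeRing)

open import Defs

ℚ-ring : AlmostCommutativeRing 0ℓ 0ℓ
ℚ-ring = fromCommutativeRing +-*-commutativeRing (λ x → dec⇒maybe (0ℚ ≟ x))

0<1 : 0ℚ < 1ℚ
0<1 = positive⁻¹ 1ℚ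

2ℚ : ℚ
2ℚ = 1ℚ + 1ℚ

p<q⇒0<q-p : ∀ {p q} → p < q → 0ℚ < q - p
p<q⇒0<q-p {p} {q} p<q = subst (_< q - p) (+-inverseʳ p) (+-monoˡ-< (- p) p<q)

p≤q⇒0≤q-p : ∀ {p q} → p ≤ q → 0ℚ ≤ q - p
p≤q⇒0≤q-p {p} {q} p≤q = subst (_≤ q - p) (+-inverseʳ p) (+-monoˡ-≤ (- p) p≤q)

q-p+p≡q : ∀ p q → q - p + p ≡ q
q-p+p≡q = solve-∀ ℚ-ring

0<q-p⇒p<q : ∀ {p q} → 0ℚ < q - p → p < q
0<q-p⇒p<q {p} {q} 0<q-p = subst₂ _<_ (+-identityˡ p) (q-p+p≡q p q) (+-monoˡ-< p 0<q-p)

0≤q-p⇒p≤q : ∀ {p q} → 0ℚ ≤ q - p → p ≤ q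
0≤q-p⇒p≤q {p} {q} 0≤q-p = subst₂ _≤_ (+-identityˡ p) (q-p+p≡q p q) (+-monoˡ-≤ p 0≤q-p)

p-q≤p : ∀ p {q} → 0ℚ ≤ q → p - q ≤ p
p-q≤p p 0≤q = subst (p - _ ≤_) (+-identityʳ p) (+-monoʳ-≤ p (neg-antimono-≤ 0≤q))

p-q<p : ∀ p {q} → 0ℚ < q → p - q < p
p-q<p p 0<q = subst (p - _ <_) (+-identityʳ p) (+-monoʳ-< p (neg-antimono-< 0<q))

fromℤ : ℤ → ℚ
fromℤ m = m / 1

fromℤ≡mkℚ : ∀ m → fromℤ m ≡ mkℚ m 0 (Coprime.sym (1-coprimeTo _))
fromℤ≡mkℚ m = ↥p/↧p≡p (mkℚ m 0 (Coprime.sym (1-coprimeTo _)))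

fromℤ-+ : ∀ m n → fromℤ (m ℤ.+ n) ≡ fromℤ m + fromℤ n
fromℤ-+ m n rewrite fromℤ≡mkℚ m | fromℤ≡mkℚ n =
  /-cong (sym (cong₂ ℤ._+_ (ℤ.*-identityʳ m) (ℤ.*-identityʳ n))) refl

fromℤ-neg : ∀ m → fromℤ (ℤ.- m) ≡ - fromℤ m
fromℤ-neg m = inverseʳ-unique (fromℤ m) (fromℤ (ℤ.- m))
  (trans (sym (fromℤ-+ m (ℤ.- m))) (cong fromℤ (ℤ.+-inverseʳ m)))

fromℤ-- : ∀ m n → fromℤ (m ℤ.- n) ≡ fromℤ m - fromℤ n
fromℤ-- m n = trans (fromℤ-+ m (ℤ.- n)) (cong (_+_ (fromℤ m)) (fromℤ-neg n))

fromℤ-suc : ∀ i → fromℤ (ℤ.+ ℕ.suc i) ≡ fromℤ (ℤ.+ i) + 1ℚ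
fromℤ-suc i = trans (cong (fromℤ ∘ ℤ.+_) (ℕ.+-comm 1 i)) (fromℤ-+ (ℤ.+ i) (ℤ.+ 1))

fromℤ-mono-≤ : ∀ {m n} → m ℕ.≤ n → fromℤ (ℤ.+ m) ≤ fromℤ (ℤ.+ n)
fromℤ-mono-≤ {m} {n} m≤n rewrite fromℤ≡mkℚ (ℤ.+ m) | fromℤ≡mkℚ (ℤ.+ n) =
  *≤* (subst₂ ℤ._≤_ (sym (ℤ.*-identityʳ (ℤ.+ m))) (sym (ℤ.*-identityʳ (ℤ.+ n))) (ℤ.+≤+ m≤n))

fromℤ<1⇒≤0 : ∀ m → fromℤ m < 1ℚ → fromℤ m ≤ 0ℚ
fromℤ<1⇒≤0 m m<1 rewrite fromℤ≡mkℚ m =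
  *≤* (subst (ℤ._≤ ℤ.+ 0) (sym (ℤ.*-identityʳ m))
        (ℤ.i<j⇒i≤pred[j] (subst (ℤ._< ℤ.+ 1) (ℤ.*-identityʳ m) (drop-*<* m<1))))

fromℤ-between-±1⇒0 : ∀ m → - 1ℚ < fromℤ m → fromℤ m < 1ℚ → fromℤ m ≡ 0ℚ
fromℤ-between-±1⇒0 m -1<m m<1 = ≤-antisym (fromℤ<1⇒≤0 m m<1) 0≤m
  where
  -m<1 : fromℤ (ℤ.- m) < 1ℚ
  -m<1 = subst₂ _<_ (sym (fromℤ-neg m)) refl (neg-antimono-< -1<m)
  0≤m : 0ℚ ≤ fromℤ m
  0≤m = subst₂ _≤_ refl (trans (sym (fromℤ-neg (ℤ.- m))) (cong fromℤ (ℤ.neg-involutive m)))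
          (neg-antimono-≤ (fromℤ<1⇒≤0 (ℤ.- m) -m<1))

multiple-within-±p≡0 : ∀ {p} m → 0ℚ < p → - p < fromℤ m * p → fromℤ m * p < p →
                       fromℤ m * p ≡ 0ℚ
multiple-within-±p≡0 {p} m p>0 -p<mp mp<p = trans (cong (_* p) m≡0) (*-zeroˡ p)
  where
  instance _ = nonNegative (<⇒≤ p>0)
  -p≡-1*p : - p ≡ - 1ℚ * p
  -p≡-1*p = trans (cong -_ (sym (*-identityˡ p))) (neg-distribˡ-* 1ℚ p)
  m≡0 : fromℤ m ≡ 0ℚ
  m≡0 = fromℤ-between-±1⇒0 m
    (*-cancelʳ-<-nonNeg p (subst (_< fromℤ m * p) -p≡-1*p -p<mp))
    (*-cancelʳ-<-nonNeg p (subst (fromℤ m * p <_) (sym (*-identityˡ p)) mp<p))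

positive-multiple-≥p : ∀ {p} m → 0ℚ < p → 0ℚ < fromℤ m * p → p ≤ fromℤ m * p
positive-multiple-≥p {p} m p>0 mp>0 = ≮⇒≥ λ mp<p →
  <-irrefl (sym (multiple-within-±p≡0 m p>0 (<-trans (neg-antimono-< p>0) mp>0) mp<p)) mp>0

difference-within-±p : ∀ {p a b} → 0ℚ ≤ a → a < p → 0ℚ ≤ b → b < p → - p < a - b × a - b < p
difference-within-±p {p} {a} {b} 0≤a a<p 0≤b b<p =
    0<q-p⇒p<q (subst (0ℚ <_) (a+[p-b]≡[a-b]-[-p] a b p) (+-mono-≤-< 0≤a (p<q⇒0<q-p b<p)))
  , 0<q-p⇒p<q (subst (0ℚ <_) ([p-a]+b≡p-[a-b] a b p) (+-mono-<-≤ (p<q⇒0<q-p a<p) 0≤b))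
  where
  a+[p-b]≡[a-b]-[-p] : ∀ a b p → a + (p - b) ≡ (a - b) - (- p)
  a+[p-b]≡[a-b]-[-p] = solve-∀ ℚ-ring
  [p-a]+b≡p-[a-b] : ∀ a b p → (p - a) + b ≡ p - (a - b)
  [p-a]+b≡p-[a-b] = solve-∀ ℚ-ring

difference-of-representations : ∀ {p} r r′ m m′ → r + fromℤ m * p ≡ r′ + fromℤ m′ * p →
                                r - r′ ≡ fromℤ (m′ ℤ.- m) * p
difference-of-representations {p} r r′ m m′ e =
  trans (cancel r r′ (fromℤ m) (fromℤ m′) e) (cong (_* p) (sym (fromℤ-- m′ m)))
  where
  cancel : ∀ r r′ M M′ → r + M * p ≡ r′ + M′ * p → r - r′ ≡ (M′ - M) * p
  cancel r r′ M M′ e = begin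
    r - r′                                          ≡⟨ solve (r ∷ r′ ∷ M ∷ M′ ∷ p ∷ []) ℚ-ring ⟩
    (r + M * p) - (r′ + M′ * p) + (M′ - M) * p      ≡⟨ cong (λ z → z - (r′ + M′ * p) + (M′ - M) * p) e ⟩
    (r′ + M′ * p) - (r′ + M′ * p) + (M′ - M) * p    ≡⟨ solve (r′ ∷ M ∷ M′ ∷ p ∷ []) ℚ-ring ⟩
    (M′ - M) * p                                    ∎
    where open ≡-Reasoning

IsMod-unique : ∀ {p x r r′} → 0ℚ < p → IsMod p x r → IsMod p x r′ → r ≡ r′
IsMod-unique {p} {x} {r} {r′} p>0 (0≤r , r<p , m , x≡) (0≤r′ , r′<p , m′ , x≡′) =
  x∙y⁻¹≈ε⇒x≈y r r′ (trans r-r′≡kp (multiple-within-±p≡0 (m′ ℤ.- m) p>0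
    (subst (- p <_) r-r′≡kp -p<r-r′) (subst (_< p) r-r′≡kp r-r′<p)))
  where
  -p<r-r′ : - p < r - r′
  -p<r-r′ = proj₁ (difference-within-±p 0≤r r<p 0≤r′ r′<p)
  r-r′<p : r - r′ < p
  r-r′<p = proj₂ (difference-within-±p 0≤r r<p 0≤r′ r′<p)
  r-r′≡kp : r - r′ ≡ fromℤ (m′ ℤ.- m) * p
  r-r′≡kp = difference-of-representations r r′ m m′ (trans (sym x≡) x≡′)

IsMod-self : ∀ {p x} → 0ℚ ≤ x → x < p → IsMod p x x
IsMod-self {p} {x} 0≤x x<p = 0≤x , x<p , ℤ.+ 0 , sym (trans (cong (_+_ x) (*-zeroˡ p)) (+-identityʳ x))

IsMod-add : ∀ {p x r} h → IsMod p x r → 0ℚ ≤ r + h → r + h < p → IsMod p (x + h) (r + h)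
IsMod-add {p} {x} {r} h (_ , _ , m , x≡) 0≤r+h r+h<p = 0≤r+h , r+h<p , m , shift x r (fromℤ m) x≡
  where
  shift : ∀ x r M → x ≡ r + M * p → x + h ≡ (r + h) + M * p
  shift _ r M refl = solve (r ∷ M ∷ p ∷ h ∷ []) ℚ-ring

IsMod-sub : ∀ {p x y d e} → IsMod p x d → IsMod p y e → e ≤ d → IsMod p (x - y) (d - e)
IsMod-sub {p} {x} {y} {d} {e} (_ , d<p , m , x≡) (0≤e , _ , n , y≡) e≤d =
    p≤q⇒0≤q-p e≤d
  , ≤-<-trans (0≤q-p⇒p≤q (subst (0ℚ ≤_) (e≡d-[d-e] d e) 0≤e)) d<p
  , m ℤ.- n
  , trans (subtract x y (fromℤ m) (fromℤ n) x≡ y≡) (cong (λ k → (d - e) + k * p) (sym (fromℤ-- m n)))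
  where
  e≡d-[d-e] : ∀ d e → e ≡ d - (d - e)
  e≡d-[d-e] = solve-∀ ℚ-ring
  subtract : ∀ x y M N → x ≡ d + M * p → y ≡ e + N * p → x - y ≡ (d - e) + (M - N) * p
  subtract _ _ M N refl refl = solve (d ∷ e ∷ M ∷ N ∷ p ∷ []) ℚ-ring

IsMod-swap : ∀ {p x y d} → IsMod p (x - y) d → 0ℚ < d → IsMod p (y - x) (p - d)
IsMod-swap {p} {x} {y} {d} (0≤d , d<p , m , x-y≡) 0<d =
    <⇒≤ (p<q⇒0<q-p d<p)
  , 0<q-p⇒p<q (subst (0ℚ <_) (d≡p-[p-d] p d) 0<d)
  , ℤ.- m ℤ.- ℤ.1ℤ
  , trans (negate (fromℤ m) x-y≡) (cong (λ k → (p - d) + k * p) (sym (fromℤ-[-m-1] m)))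
  where
  d≡p-[p-d] : ∀ p d → d ≡ p - (p - d)
  d≡p-[p-d] = solve-∀ ℚ-ring
  fromℤ-[-m-1] : ∀ m → fromℤ (ℤ.- m ℤ.- ℤ.1ℤ) ≡ - fromℤ m - 1ℚ
  fromℤ-[-m-1] m = trans (fromℤ-- (ℤ.- m) ℤ.1ℤ) (cong (_- 1ℚ) (fromℤ-neg m))
  negate : ∀ M → x - y ≡ d + M * p → y - x ≡ (p - d) + (- M - 1ℚ) * p
  negate M e = begin
    y - x                       ≡⟨ solve (x ∷ y ∷ []) ℚ-ring ⟩
    - (x - y)                   ≡⟨ cong -_ e ⟩
    - (d + M * p)               ≡⟨ solve (d ∷ M ∷ p ∷ []) ℚ-ring ⟩
    (p - d) + (- M - 1ℚ) * p    ∎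
    where open ≡-Reasoning

wrap : ℚ → ℚ → ℚ
wrap p x with 0ℚ ≤? x
... | yes _ = x
... | no _  = x + p

IsMod-wrap : ∀ {p x} → - p ≤ x → x < p → IsMod p x (wrap p x)
IsMod-wrap {p} {x} -p≤x x<p with 0ℚ ≤? x
... | yes 0≤x = IsMod-self 0≤x x<p
... | no x≱0  =
    subst (0ℚ ≤_) (x-[-p]≡x+p x p) (p≤q⇒0≤q-p -p≤x)
  , 0<q-p⇒p<q (subst (0ℚ <_) (0-x≡p-[x+p] x p) (p<q⇒0<q-p (≰⇒> x≱0)))
  , ℤ.-1ℤ
  , x≡[x+p]-p x p
  where
  x-[-p]≡x+p : ∀ x p → x - (- p) ≡ x + p
  x-[-p]≡x+p = solve-∀ ℚ-ring
  0-x≡p-[x+p] : ∀ x p → 0ℚ - x ≡ p - (x + p)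
  0-x≡p-[x+p] = solve-∀ ℚ-ring
  x≡[x+p]-p : ∀ x p → x ≡ (x + p) + - 1ℚ * p
  x≡[x+p]-p = solve-∀ ℚ-ring

lag>p-1⇒InUnitIntervalFrom : ∀ {p a y d} → 1ℚ ≤ p → IsMod p (a - y) d → p - 1ℚ < d →
                              InUnitIntervalFrom p a y
lag>p-1⇒InUnitIntervalFrom {p} {a} {y} {d} 1≤p a-y≡d p-1<d =
  p - d , IsMod-swap {x = a} {y} a-y≡d 0<d , p<q⇒0<q-p (proj₁ (proj₂ a-y≡d)) , p-d<1
  where
  0<d : 0ℚ < d
  0<d = ≤-<-trans (p≤q⇒0≤q-p 1≤p) p-1<d
  p-d<1 : p - d < 1ℚ
  p-d<1 = 0<q-p⇒p<q (subst (0ℚ <_) (d-[p-1]≡1-[p-d] p d) (p<q⇒0<q-p p-1<d))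
    where d-[p-1]≡1-[p-d] : ∀ p d → d - (p - 1ℚ) ≡ 1ℚ - (p - d)
          d-[p-1]≡1-[p-d] = solve-∀ ℚ-ring

progression-in-unit-arc⇒n*h<1 : ∀ {p a h} n → 0ℚ ≤ h → 1ℚ + h ≤ p →
  (∀ i → i ℕ.≤ n → InUnitIntervalFrom p a (fromℤ (ℤ.+ i) * h)) → fromℤ (ℤ.+ n) * h < 1ℚ
progression-in-unit-arc⇒n*h<1 {p} {a} {h} n 0≤h 1+h≤p inArc =
  ≤-<-trans (subst (_≤ r₀ + fromℤ (ℤ.+ n) * h) (+-identityˡ _) (+-monoˡ-≤ _ (<⇒≤ 0<r₀)))
            (below-1 n ℕ.≤-refl)
  where
  p>0 : 0ℚ < p
  p>0 = <-≤-trans (+-mono-<-≤ 0<1 0≤h) 1+h≤p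
  r₀ : ℚ
  r₀ = proj₁ (inArc 0 ℕ.z≤n)
  0<r₀ : 0ℚ < r₀
  0<r₀ = proj₁ (proj₂ (proj₂ (inArc 0 ℕ.z≤n)))
  representative : ∀ i → i ℕ.≤ n → IsMod p (fromℤ (ℤ.+ i) * h - a) (r₀ + fromℤ (ℤ.+ i) * h)
  below-1 : ∀ i → i ℕ.≤ n → r₀ + fromℤ (ℤ.+ i) * h < 1ℚ
  below-1 i i≤n with inArc i i≤n
  ... | r , isMod , _ , r<1 = subst (_< 1ℚ) (IsMod-unique p>0 isMod (representative i i≤n)) r<1
  representative ℕ.zero _ =
    subst (IsMod p _) (r≡r+0*h r₀ h) (proj₁ (proj₂ (inArc 0 ℕ.z≤n)))
    where r≡r+0*h : ∀ r h → r ≡ r + 0ℚ * h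
          r≡r+0*h = solve-∀ ℚ-ring
  representative (ℕ.suc i) i<n rewrite fromℤ-suc i =
    subst₂ (IsMod p) (shift-point (fromℤ (ℤ.+ i)) a) (shift-representative r₀ (fromℤ (ℤ.+ i)))
      (IsMod-add h (representative i i≤n) (+-mono-≤ (proj₁ (representative i i≤n)) 0≤h)
         (<-≤-trans (+-monoˡ-< h (below-1 i i≤n)) 1+h≤p))
    where
    i≤n = ℕ.<⇒≤ i<n
    shift-point : ∀ I a → I * h - a + h ≡ (I + 1ℚ) * h - a
    shift-point I a = solve (I ∷ a ∷ h ∷ []) ℚ-ring
    shift-representative : ∀ r I → r + I * h + h ≡ r + (I + 1ℚ) * h
    shift-representative r I = solve (r ∷ I ∷ h ∷ []) ℚ-ring

module _ {a ℓ} {A : Set a} {_≼_ : A → A → Set ℓ}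
         (≼-refl : Reflexive _≼_) (≼-trans : Transitive _≼_) where

  chain-from-zero : ∀ {k} (g : Fin (ℕ.suc k) → A) → (∀ t → g (inject₁ t) ≼ g (suc t)) →
                    ∀ t → g zero ≼ g t
  chain-from-zero g step zero = ≼-refl
  chain-from-zero {ℕ.suc k} g step (suc t) =
    ≼-trans (chain-from-zero (g ∘ inject₁) (step ∘ inject₁) t) (step t)

  chain-to-last : ∀ {k} (g : Fin (ℕ.suc k) → A) → (∀ t → g (inject₁ t) ≼ g (suc t)) →
                  ∀ t → g t ≼ g (Fin.fromℕ k)
  chain-to-last {ℕ.zero} g step zero = ≼-refl
  chain-to-last {ℕ.suc k} g step zero = ≼-trans (step zero) (chain-to-last (g ∘ suc) (step ∘ suc) zero)
  chain-to-last {ℕ.suc k} g step (suc t) = chain-to-last (g ∘ suc) (step ∘ suc) t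

record Lag (p x y d : ℚ) : Set where
  constructor lag
  field
    turns : ℤ
    x-y≡  : x - y ≡ d + fromℤ turns * p

Lag-refl : ∀ {p} x → Lag p x x 0ℚ
Lag-refl {p} x = lag (ℤ.+ 0) (x-x≡0+0*p x)
  where x-x≡0+0*p : ∀ x → x - x ≡ 0ℚ + 0ℚ * p
        x-x≡0+0*p x = solve (x ∷ p ∷ []) ℚ-ring

Lag-trans : ∀ {p x y z d e} → Lag p x y d → Lag p y z e → Lag p x z (d + e)
Lag-trans {p} {x} {y} {z} {d} {e} (lag m x-y≡) (lag k y-z≡) =
  lag (m ℤ.+ k) (trans (add x y z (fromℤ m) (fromℤ k) x-y≡ y-z≡)
                       (cong (λ M → d + e + M * p) (sym (fromℤ-+ m k))))
  where
  add : ∀ x y z M K → x - y ≡ d + M * p → y - z ≡ e + K * p → x - z ≡ (d + e) + (M + K) * p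
  add x y z M K x-y≡ y-z≡ = begin
    x - z                        ≡⟨ solve (x ∷ y ∷ z ∷ []) ℚ-ring ⟩
    (x - y) + (y - z)            ≡⟨ cong₂ _+_ x-y≡ y-z≡ ⟩
    (d + M * p) + (e + K * p)    ≡⟨ solve (d ∷ e ∷ M ∷ K ∷ p ∷ []) ℚ-ring ⟩
    (d + e) + (M + K) * p        ∎
    where open ≡-Reasoning

IsMod⇒Lag : ∀ {p x y d} → IsMod p (x - y) d → Lag p x y d
IsMod⇒Lag (_ , _ , m , x-y≡) = lag m x-y≡

IsMod-shift⇒Lag : ∀ {p x θ a} → IsMod p (x - θ) a → Lag p x a θ
IsMod-shift⇒Lag {p} {x} {θ} {a} (_ , _ , m , x-θ≡) = lag m (rearrange x (fromℤ m) x-θ≡)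
  where rearrange : ∀ x M → x - θ ≡ a + M * p → x - a ≡ θ + M * p
        rearrange x M e = begin
          x - a                 ≡⟨ solve (x ∷ a ∷ θ ∷ []) ℚ-ring ⟩
          (x - θ) - a + θ       ≡⟨ cong (λ z → z - a + θ) e ⟩
          (a + M * p) - a + θ   ≡⟨ solve (a ∷ M ∷ p ∷ θ ∷ []) ℚ-ring ⟩
          θ + M * p             ∎
          where open ≡-Reasoning

module LaggingWalk {n p w} (x : Fin (ℕ.suc n) → ℚ) (p>0 : 0ℚ < p)
  (lagging : ∀ v → ∃₂ λ u d → 0ℚ < d × d ≤ w × Lag p (x v) (x u) d) where

  next : Fin (ℕ.suc n) → Fin (ℕ.suc n)
  next v = proj₁ (lagging v)

  lagOf : Fin (ℕ.suc n) → ℚ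
  lagOf v = proj₁ (proj₂ (lagging v))

  lagOf>0 : ∀ v → 0ℚ < lagOf v
  lagOf>0 v = proj₁ (proj₂ (proj₂ (lagging v)))

  lagOf≤w : ∀ v → lagOf v ≤ w
  lagOf≤w v = proj₁ (proj₂ (proj₂ (proj₂ (lagging v))))

  lagOf-Lag : ∀ v → Lag p (x v) (x (next v)) (lagOf v)
  lagOf-Lag v = proj₂ (proj₂ (proj₂ (proj₂ (lagging v))))

  visit : ℕ → Fin (ℕ.suc n)
  visit ℕ.zero = zero
  visit (ℕ.suc t) = next (visit t)

  travelled : ℕ → ℚ
  travelled ℕ.zero = 0ℚ
  travelled (ℕ.suc t) = travelled t + lagOf (visit t)

  travelled-Lag : ∀ t → Lag p (x zero) (x (visit t)) (travelled t)
  travelled-Lag ℕ.zero = Lag-refl (x zero)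
  travelled-Lag (ℕ.suc t) = Lag-trans (travelled-Lag t) (lagOf-Lag (visit t))

  travelled-increasing : ∀ t → travelled t < travelled (ℕ.suc t)
  travelled-increasing t = subst₂ _<_ (+-identityʳ (travelled t)) refl
    (+-monoʳ-< (travelled t) (lagOf>0 (visit t)))

  travelled-mono : ∀ {s t} → s ℕ.≤ t → travelled s ≤ travelled t
  travelled-mono s≤t = go (ℕ.≤⇒≤′ s≤t)
    where
    go : ∀ {s t} → s ℕ.≤′ t → travelled s ≤ travelled t
    go ℕ.≤′-refl = ≤-refl
    go {t = ℕ.suc t} (ℕ.≤′-step s≤′t) = ≤-trans (go s≤′t) (<⇒≤ (travelled-increasing t))

  travelled-strict : ∀ {s t} → s ℕ.< t → travelled s < travelled t
  travelled-strict {s} s<t = <-≤-trans (travelled-increasing s) (travelled-mono s<t)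

  travelled≤t*w : ∀ t → travelled t ≤ fromℤ (ℤ.+ t) * w
  travelled≤t*w ℕ.zero = ≤-reflexive (sym (*-zeroˡ w))
  travelled≤t*w (ℕ.suc t) =
    subst (travelled (ℕ.suc t) ≤_) (sym (trans (cong (_* w) (fromℤ-suc t)) (distrib (fromℤ (ℤ.+ t)))))
      (+-mono-≤ (travelled≤t*w t) (lagOf≤w (visit t)))
    where distrib : ∀ I → (I + 1ℚ) * w ≡ I * w + w
          distrib I = solve (I ∷ w ∷ []) ℚ-ring

  -- Some point is visited twice within n + 2 steps, and in between the walk travels a
  -- positive multiple of p.
  p≤n*w : p ≤ fromℤ (ℤ.+ ℕ.suc n) * w
  p≤n*w with Fin.pigeonhole (ℕ.n<1+n (ℕ.suc n)) (visit ∘ toℕ)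
  ... | s , t , s<t , same-visit with travelled-Lag (toℕ s) | travelled-Lag (toℕ t)
  ... | lag mₛ eₛ | lag mₜ eₜ = begin
    p                                       ≤⟨ positive-multiple-≥p (mₛ ℤ.- mₜ) p>0 gap>0 ⟩
    fromℤ (mₛ ℤ.- mₜ) * p                   ≡⟨ sym gap≡ ⟩
    travelled (toℕ t) - travelled (toℕ s)   ≤⟨ p-q≤p _ (travelled-mono {t = toℕ s} ℕ.z≤n) ⟩
    travelled (toℕ t)                       ≤⟨ travelled-mono (ℕ.≤-pred (Fin.toℕ<n t)) ⟩
    travelled (ℕ.suc n)                     ≤⟨ travelled≤t*w (ℕ.suc n) ⟩
    fromℤ (ℤ.+ ℕ.suc n) * w                 ∎
    where
    open ≤-Reasoning
    gap≡ : travelled (toℕ t) - travelled (toℕ s) ≡ fromℤ (mₛ ℤ.- mₜ) * p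
    gap≡ = difference-of-representations (travelled (toℕ t)) (travelled (toℕ s)) mₜ mₛ
             (trans (sym eₜ) (trans (cong (λ v → x zero - x v) (sym same-visit)) eₛ))
    gap>0 : 0ℚ < fromℤ (mₛ ℤ.- mₜ) * p
    gap>0 = subst (0ℚ <_) gap≡ (p<q⇒0<q-p (travelled-strict s<t))

lagging-successors⇒p≤n*w : ∀ {n p w} (x : Fin (ℕ.suc n) → ℚ) → 0ℚ < p →
  (∀ v → ∃₂ λ u d → 0ℚ < d × d ≤ w × Lag p (x v) (x u) d) → p ≤ fromℤ (ℤ.+ ℕ.suc n) * w
lagging-successors⇒p≤n*w = LaggingWalk.p≤n*w

unit-arc-misses-point : ∀ {n p a} (x : Fin n → ℚ) → 1ℚ ≤ p → 0ℚ ≤ a → a < p →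
  (∀ i → 0ℚ ≤ x i × x i < p) → ¬ (∀ i → InUnitIntervalFrom p a (x i)) →
  ∃₂ λ i d → IsMod p (a - x i) d × d ≤ p - 1ℚ
unit-arc-misses-point {n} {p} {a} x 1≤p 0≤a a<p x-bounds not-all =
  let (i , not-close) = Fin.¬∀⟶∃¬ n (λ i → p - 1ℚ < lag-of i) (λ i → p - 1ℚ <? lag-of i) all-close⇒⊥
  in  i , lag-of i , lag-of-IsMod i , ≮⇒≥ not-close
  where
  lag-of : Fin n → ℚ
  lag-of i = wrap p (a - x i)
  lag-of-IsMod : ∀ i → IsMod p (a - x i) (lag-of i)
  lag-of-IsMod i = IsMod-wrap (<⇒≤ (proj₁ a-xᵢ-bounds)) (proj₂ a-xᵢ-bounds)
    where a-xᵢ-bounds = difference-within-±p 0≤a a<p (proj₁ (x-bounds i)) (proj₂ (x-bounds i))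
  all-close⇒⊥ : ¬ (∀ i → p - 1ℚ < lag-of i)
  all-close⇒⊥ all-close = not-all λ i →
    lag>p-1⇒InUnitIntervalFrom {y = x i} 1≤p (lag-of-IsMod i) (all-close i)

lagging-successor : ∀ {n p θ} (x : Fin n → ℚ) → 1ℚ ≤ p → 0ℚ < θ → θ ≤ 1ℚ →
  (∀ i → 0ℚ ≤ x i × x i < p) → (∀ a → 0ℚ ≤ a → a < p → ¬ (∀ i → InUnitIntervalFrom p a (x i))) →
  ∀ v → ∃₂ λ u d → 0ℚ < d × d ≤ θ + (p - 1ℚ) × Lag p (x v) (x u) d
-- The unit arc starting at x v − θ misses some x u, which then lags x v by θ plus at most p − 1.
lagging-successor {n} {p} {θ} x 1≤p 0<θ θ≤1 x-bounds no-arc-covers v =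
  let (u , d , u-IsMod , d≤p-1) = unit-arc-misses-point x 1≤p 0≤a a<p x-bounds (no-arc-covers a 0≤a a<p)
  in  u , θ + d , +-mono-<-≤ 0<θ (proj₁ u-IsMod) , +-monoʳ-≤ θ d≤p-1 ,
      Lag-trans (IsMod-shift⇒Lag a-IsMod) (IsMod⇒Lag u-IsMod)
  where
  a : ℚ
  a = wrap p (x v - θ)
  -p≤xᵥ-θ : - p ≤ x v - θ
  -p≤xᵥ-θ = ≤-trans (neg-antimono-≤ (≤-trans θ≤1 1≤p))
              (subst (_≤ x v - θ) (+-identityˡ (- θ)) (+-monoˡ-≤ (- θ) (proj₁ (x-bounds v))))
  a-IsMod : IsMod p (x v - θ) a
  a-IsMod = IsMod-wrap -p≤xᵥ-θ (<-trans (p-q<p (x v) 0<θ) (proj₂ (x-bounds v)))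
  0≤a : 0ℚ ≤ a
  0≤a = proj₁ a-IsMod
  a<p : a < p
  a<p = proj₁ (proj₂ a-IsMod)

uncovered-points⇒p≤n*[θ+p-1] : ∀ {n p θ} (x : Fin (ℕ.suc n) → ℚ) → 1ℚ ≤ p → 0ℚ < θ → θ ≤ 1ℚ →
  (∀ i → 0ℚ ≤ x i × x i < p) → (∀ a → 0ℚ ≤ a → a < p → ¬ (∀ i → InUnitIntervalFrom p a (x i))) →
  p ≤ fromℤ (ℤ.+ ℕ.suc n) * (θ + (p - 1ℚ))
uncovered-points⇒p≤n*[θ+p-1] x 1≤p 0<θ θ≤1 x-bounds no-arc-covers =
  lagging-successors⇒p≤n*w x (<-≤-trans 0<1 1≤p) (lagging-successor x 1≤p 0<θ θ≤1 x-bounds no-arc-covers)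

1/suc : ℕ → ℚ
1/suc n = mkℚ (ℤ.+ 1) n (1-coprimeTo _)

0<1/suc : ∀ n → 0ℚ < 1/suc n
0<1/suc n = positive⁻¹ (1/suc n)

1/suc≤1 : ∀ n → 1/suc n ≤ 1ℚ
1/suc≤1 n = *≤* (ℤ.+≤+ (ℕ.s≤s ℕ.z≤n))

suc*1/suc≡1 : ∀ n → fromℤ (ℤ.+ ℕ.suc n) * 1/suc n ≡ 1ℚ
suc*1/suc≡1 n rewrite fromℤ≡mkℚ (ℤ.+ ℕ.suc n) =
  *-inverseʳ (mkℚ (ℤ.+ ℕ.suc n) 0 (Coprime.sym (1-coprimeTo _)))

1/suc-below : ∀ ε → 0ℚ < ε → ∃ λ n → 1/suc n ≤ ε
1/suc-below (mkℚ (ℤ.+ ℕ.suc a) d _) _ = d , *≤* (ℤ.+≤+ (ℕ.*-monoˡ-≤ (ℕ.suc d) (ℕ.s≤s (ℕ.z≤n {a}))))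
1/suc-below (mkℚ (ℤ.+ ℕ.zero) d _) (*<* (ℤ.+<+ ()))
1/suc-below (mkℚ ℤ.-[1+ _ ] d _) (*<* ())

positive-θ-with-n*θ<q : ∀ n {q} → 0ℚ < q → ∃ λ θ → 0ℚ < θ × θ ≤ q × fromℤ (ℤ.+ n) * θ < q
positive-θ-with-n*θ<q n {q} 0<q = q * ε , 0<θ , θ≤q , nθ<q
  where
  instance
    _ = positive 0<q
    _ = nonNegative (<⇒≤ 0<q)
  ε = 1/suc n
  0<θ : 0ℚ < q * ε
  0<θ = positive⁻¹ (q * ε) {{pos*pos⇒pos q ε}}
  θ≤q : q * ε ≤ q
  θ≤q = subst (q * ε ≤_) (*-identityʳ q) (*-monoˡ-≤-nonNeg q (1/suc≤1 n))
  nθ<q : fromℤ (ℤ.+ n) * (q * ε) < q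
  nθ<q = subst (_< q) (sym nθ≡q-θ) (p-q<p q 0<θ)
    where
    nθ≡q-θ : fromℤ (ℤ.+ n) * (q * ε) ≡ q - q * ε
    nθ≡q-θ = begin
      fromℤ (ℤ.+ n) * (q * ε)                  ≡⟨ rearrange (fromℤ (ℤ.+ n)) q ε ⟩
      q * ((fromℤ (ℤ.+ n) + 1ℚ) * ε) - q * ε   ≡⟨ cong (λ z → q * (z * ε) - q * ε) (sym (fromℤ-suc n)) ⟩
      q * (fromℤ (ℤ.+ ℕ.suc n) * ε) - q * ε    ≡⟨ cong (λ z → q * z - q * ε) (suc*1/suc≡1 n) ⟩
      q * 1ℚ - q * ε                           ≡⟨ cong (_- q * ε) (*-identityʳ q) ⟩
      q - q * ε                                ∎
      where
      open ≡-Reasoning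
      rearrange : ∀ n q ε → n * (q * ε) ≡ q * ((n + 1ℚ) * ε) - q * ε
      rearrange n q ε = solve (n ∷ q ∷ ε ∷ []) ℚ-ring

slack-below-1+1/suc : ∀ n {p} → 1ℚ ≤ p → p < 1ℚ + 1/suc n →
  ∃ λ θ → 0ℚ < θ × θ ≤ 1ℚ × fromℤ (ℤ.+ ℕ.suc (ℕ.suc n)) * (θ + (p - 1ℚ)) < p
slack-below-1+1/suc n {p} 1≤p p<1+h =
  let (θ , 0<θ , θ≤q , Kθ<q) = positive-θ-with-n*θ<q (ℕ.suc (ℕ.suc n)) (p<q⇒0<q-p NL<1)
  in  θ , 0<θ , ≤-trans θ≤q (p-q≤p 1ℚ 0≤NL) , (begin-strict
        K * (θ + L)                 ≡⟨ *-distribˡ-+ K θ L ⟩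
        K * θ + K * L               ≡⟨ cong (λ k → K * θ + k * L) (fromℤ-suc (ℕ.suc n)) ⟩
        K * θ + (N + 1ℚ) * L        ≡⟨ cong (_+_ (K * θ)) (distrib N L) ⟩
        K * θ + (N * L + L)         <⟨ +-monoˡ-< (N * L + L) Kθ<q ⟩
        (1ℚ - N * L) + (N * L + L)  ≡⟨ cancel (N * L) L ⟩
        1ℚ + L                      ≡⟨ 1+[p-1]≡p p ⟩
        p                           ∎)
  where
  open ≤-Reasoning
  h = 1/suc n
  N = fromℤ (ℤ.+ ℕ.suc n)
  K = fromℤ (ℤ.+ ℕ.suc (ℕ.suc n))
  L = p - 1ℚ
  0<N : 0ℚ < N
  0<N = <-≤-trans 0<1 (fromℤ-mono-≤ {1} {ℕ.suc n} (ℕ.s≤s ℕ.z≤n))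
  instance _ = positive 0<N
  L<h : L < h
  L<h = 0<q-p⇒p<q (subst (0ℚ <_) (rearrange p h) (p<q⇒0<q-p p<1+h))
    where rearrange : ∀ p h → (1ℚ + h) - p ≡ h - (p - 1ℚ)
          rearrange = solve-∀ ℚ-ring
  NL<1 : N * L < 1ℚ
  NL<1 = subst (N * L <_) (suc*1/suc≡1 n) (*-monoʳ-<-pos N L<h)
  0≤NL : 0ℚ ≤ N * L
  0≤NL = nonNegative⁻¹ (N * L)
           {{nonNeg*nonNeg⇒nonNeg N {{nonNegative (<⇒≤ 0<N)}} L {{nonNegative (p≤q⇒0≤q-p 1≤p)}}}}
  distrib : ∀ N L → (N + 1ℚ) * L ≡ N * L + L
  distrib = solve-∀ ℚ-ring
  cancel : ∀ NL L → (1ℚ - NL) + (NL + L) ≡ 1ℚ + L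
  cancel = solve-∀ ℚ-ring
  1+[p-1]≡p : ∀ p → 1ℚ + (p - 1ℚ) ≡ p
  1+[p-1]≡p = solve-∀ ℚ-ring

cyclic-descent-is-constant : ∀ {A : Set} {k} (c : Fin (ℕ.suc k) → A) (φ : A → ℚ) →
  (∀ t → c (inject₁ t) ≡ c (suc t) ⊎ φ (c (suc t)) < φ (c (inject₁ t))) →
  c (Fin.fromℕ k) ≡ c zero ⊎ φ (c zero) < φ (c (Fin.fromℕ k)) →
  ∀ t → c zero ≡ c t
cyclic-descent-is-constant {k = k} c φ step close =
  chain-from-zero {_≼_ = _≡_} refl trans c constant-step
  where
  weakly : ∀ {a b} → a ≡ b ⊎ φ b < φ a → φ b ≤ φ a
  weakly (inj₁ refl)  = ≤-refl
  weakly (inj₂ φb<φa) = <⇒≤ φb<φa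
  descending : ∀ t → φ (c (suc t)) ≤ φ (c (inject₁ t))
  descending t = weakly (step t)
  ≤-start : ∀ t → φ (c t) ≤ φ (c zero)
  ≤-start = chain-from-zero {_≼_ = _≥_} ≤-refl (flip ≤-trans) (φ ∘ c) descending
  end-≤ : ∀ t → φ (c (Fin.fromℕ k)) ≤ φ (c t)
  end-≤ = chain-to-last {_≼_ = _≥_} ≤-refl (flip ≤-trans) (φ ∘ c) descending
  constant-step : ∀ t → c (inject₁ t) ≡ c (suc t)
  constant-step t with step t
  ... | inj₁ same = same
  ... | inj₂ drop = ⊥-elim (<-irrefl refl
          (<-≤-trans drop (≤-trans (≤-start (inject₁ t)) (≤-trans (weakly close) (end-≤ (suc t))))))

WeakArcCondition : ℚ → ℚ → ℚ → Set
WeakArcCondition p a b = a ≡ b ⊎ ∃ λ r → IsMod p (b - a) r × 1ℚ ≤ r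

weak-arc-target-outside-unit-arc : ∀ {p a b} → 0ℚ < p → WeakArcCondition p a b →
                                   ¬ InUnitIntervalFrom p a b
weak-arc-target-outside-unit-arc {p} {a} p>0 (inj₁ refl) (r , a-a≡r , 0<r , _) =
  <-irrefl (IsMod-unique p>0 (IsMod-self ≤-refl p>0) (subst (λ x → IsMod p x r) (+-inverseʳ a) a-a≡r))
           0<r
weak-arc-target-outside-unit-arc p>0 (inj₂ (r′ , b-a≡r′ , 1≤r′)) (r , b-a≡r , _ , r<1) =
  <-irrefl refl (<-≤-trans (subst (_< 1ℚ) (IsMod-unique p>0 b-a≡r b-a≡r′) r<1) 1≤r′)

module Lead {p s} (1≤p : 1ℚ ≤ p) (0≤s : 0ℚ ≤ s) (s<p : s < p) where

  lead : ℚ → ℚ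
  lead a = wrap p (a - s)

  lead-IsMod : ∀ {a} → 0ℚ ≤ a → a < p → IsMod p (a - s) (lead a)
  lead-IsMod 0≤a a<p = IsMod-wrap (<⇒≤ (proj₁ bounds)) (proj₂ bounds)
    where bounds = difference-within-±p 0≤a a<p 0≤s s<p

  weak-arc-to-s⇒lead≤p-1 : ∀ {a} → 0ℚ ≤ a → a < p → WeakArcCondition p a s → lead a ≤ p - 1ℚ
  weak-arc-to-s⇒lead≤p-1 {a} 0≤a a<p arc = ≮⇒≥ λ p-1<lead →
    weak-arc-target-outside-unit-arc (<-≤-trans 0<1 1≤p) arc
      (lag>p-1⇒InUnitIntervalFrom {y = s} 1≤p (lead-IsMod 0≤a a<p) p-1<lead)

  weak-arc-lowers-lead : ∀ {a b} → p < 2ℚ → 0ℚ ≤ a → a < p → 0ℚ ≤ b → b < p →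
    lead b ≤ p - 1ℚ → WeakArcCondition p a b → a ≡ b ⊎ lead b < lead a
  weak-arc-lowers-lead p<2 0≤a a<p 0≤b b<p lead≤p-1 (inj₁ a≡b) = inj₁ a≡b
  weak-arc-lowers-lead {a} {b} p<2 0≤a a<p 0≤b b<p lead≤p-1 (inj₂ (r , b-a≡r , 1≤r))
    with lead a ≤? lead b
  ... | no lead-a≰lead-b = inj₂ (≰⇒> lead-a≰lead-b)
  ... | yes lead-a≤lead-b = ⊥-elim (<-irrefl refl (<-≤-trans r<1 1≤r))
    where
    b-a≡gap : IsMod p (b - a) (lead b - lead a)
    b-a≡gap = subst (λ x → IsMod p x (lead b - lead a)) (cancel-s b a s)
                (IsMod-sub (lead-IsMod 0≤b b<p) (lead-IsMod 0≤a a<p) lead-a≤lead-b)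
      where cancel-s : ∀ b a s → (b - s) - (a - s) ≡ b - a
            cancel-s = solve-∀ ℚ-ring
    p-1<1 : p - 1ℚ < 1ℚ
    p-1<1 = 0<q-p⇒p<q (subst (0ℚ <_) (rearrange p) (p<q⇒0<q-p p<2))
      where rearrange : ∀ p → 2ℚ - p ≡ 1ℚ - (p - 1ℚ)
            rearrange = solve-∀ ℚ-ring
    r<1 : r < 1ℚ
    r<1 = subst (_< 1ℚ) (IsMod-unique (<-≤-trans 0<1 1≤p) b-a≡gap b-a≡r)
            (≤-<-trans (p-q≤p (lead b) (proj₁ (lead-IsMod 0≤a a<p))) (≤-<-trans lead≤p-1 p-1<1))

acyclic-by-rank : ∀ D {X : Vertex D → Set} (rank : Vertex D → ℕ) →
  (∀ {u w} → X u → X w → Arc D u w → rank u ℕ.< rank w) → InducesAcyclic D X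
acyclic-by-rank D rank rank-rises C =
  ℕ.<-irrefl refl (ℕ.≤-<-trans start≤end (rank-rises (inX _) (inX _) close))
  where
  open DirectedCycleIn C
  start≤end : rank (f zero) ℕ.≤ rank (f (Fin.fromℕ k))
  start≤end = chain-from-zero {_≼_ = ℕ._≤_} ℕ.≤-refl ℕ.≤-trans (rank ∘ f)
                (λ t → ℕ.<⇒≤ (rank-rises (inX _) (inX _) (step t))) (Fin.fromℕ k)

least-is-infimum : ∀ {S x} → S x → (∀ p → S p → x ≤ p) → IsInfimum S x
least-is-infimum {x = x} Sx x≤S = x≤S , λ δ 0<δ →
  x , Sx , subst (_< x + δ) (+-identityʳ x) (+-monoʳ-< x 0<δ)

module CycleWithSink (j : ℕ) where

  -- Vertices 0, …, N form the rim and K is the sink.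
  N K : ℕ
  N = ℕ.suc j
  K = ℕ.suc N

  IsArc : ℕ → ℕ → Set
  IsArc x y = (ℕ.suc x ≡ y × y ℕ.< K) ⊎ (x ≡ N × y ≡ 0) ⊎ (x ℕ.< K × y ≡ K)

  isArc? : ∀ x y → Dec (IsArc x y)
  isArc? x y =  (ℕ.suc x ℕ.≟ y ×-dec y ℕ.<? K)
             ⊎-dec (x ℕ.≟ N ×-dec y ℕ.≟ 0)
             ⊎-dec (x ℕ.<? K ×-dec y ℕ.≟ K)

  IsArc-irreflexive : ∀ x → ¬ IsArc x x
  IsArc-irreflexive x (inj₁ (1+x≡x , _))         = ℕ.1+n≢n 1+x≡x
  IsArc-irreflexive x (inj₂ (inj₁ (x≡N , x≡0))) = ℕ.1+n≢0 (trans (sym x≡N) x≡0)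
  IsArc-irreflexive x (inj₂ (inj₂ (x<K , x≡K))) = ℕ.<-irrefl x≡K x<K

  D : Digraph
  D = record
    { n        = ℕ.suc K
    ; arc      = λ u w → does (isArc? (toℕ u) (toℕ w))
    ; loopless = λ v → dec-false (isArc? (toℕ v) (toℕ v)) (IsArc-irreflexive (toℕ v))
    }

  Arc⇒IsArc : ∀ {u w : Vertex D} → Arc D u w → IsArc (toℕ u) (toℕ w)
  Arc⇒IsArc {u} {w} u→w =
    invert (subst (Reflects (IsArc (toℕ u) (toℕ w))) u→w (proof (isArc? (toℕ u) (toℕ w))))

  IsArc⇒Arc : ∀ {u w : Vertex D} → IsArc (toℕ u) (toℕ w) → Arc D u w
  IsArc⇒Arc {u} {w} = dec-true (isArc? (toℕ u) (toℕ w))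

  rim : Fin K → Vertex D
  rim = inject₁

  sink : Vertex D
  sink = Fin.fromℕ K

  toℕ-rim : ∀ i → toℕ (rim i) ≡ toℕ i
  toℕ-rim = Fin.toℕ-inject₁

  toℕ-rim<K : ∀ i → toℕ (rim i) ℕ.< K
  toℕ-rim<K i = subst (ℕ._< K) (sym (toℕ-rim i)) (Fin.toℕ<n i)

  rim-step : ∀ t → Arc D (rim (inject₁ t)) (rim (suc t))
  rim-step t = IsArc⇒Arc (inj₁ (cong ℕ.suc (toℕ-rim (inject₁ t)) , toℕ-rim<K (suc t)))

  rim-close : Arc D (rim (Fin.fromℕ N)) (rim zero)
  rim-close = IsArc⇒Arc (inj₂ (inj₁ (trans (toℕ-rim (Fin.fromℕ N)) (Fin.toℕ-fromℕ N) , refl)))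

  rim-to-sink : ∀ i → Arc D (rim i) sink
  rim-to-sink i = IsArc⇒Arc (inj₂ (inj₂ (toℕ-rim<K i , Fin.toℕ-fromℕ K)))

  rim-cycle : ∀ {X} → (∀ i → X (rim i)) → DirectedCycleIn D X
  rim-cycle rim⊆X = record
    { k = N ; f = rim ; inj = Fin.inject₁-injective ; inX = rim⊆X
    ; step = rim-step ; close = rim-close }

  -- Ranks list the rim from i₀ + 1 to N, then from 0 to i₀, and the sink last.
  module Rank (i₀ : ℕ) (i₀<K : i₀ ℕ.< K) where

    rank : ℕ → ℕ
    rank x with x ℕ.≤? i₀ | x ℕ.<? K
    ... | yes _ | _     = K ℕ.+ x
    ... | no _  | yes _ = x
    ... | no _  | no _  = K ℕ.+ K

    rank-≤i₀ : ∀ {x} → x ℕ.≤ i₀ → rank x ≡ K ℕ.+ x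
    rank-≤i₀ {x} x≤i₀ with x ℕ.≤? i₀
    ... | yes _   = refl
    ... | no x≰i₀ = contradiction x≤i₀ x≰i₀

    rank->i₀ : ∀ {x} → i₀ ℕ.< x → x ℕ.< K → rank x ≡ x
    rank->i₀ {x} i₀<x x<K with x ℕ.≤? i₀ | x ℕ.<? K
    ... | yes x≤i₀ | _       = contradiction x≤i₀ (ℕ.<⇒≱ i₀<x)
    ... | no _     | yes _   = refl
    ... | no _     | no x≮K  = contradiction x<K x≮K

    rank-sink : rank K ≡ K ℕ.+ K
    rank-sink with K ℕ.≤? i₀ | K ℕ.<? K
    ... | yes K≤i₀ | _     = contradiction K≤i₀ (ℕ.<⇒≱ i₀<K)
    ... | no _     | yes K<K = contradiction K<K (ℕ.<-irrefl refl)
    ... | no _     | no _  = refl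

    rank<K+K : ∀ {x} → x ℕ.< K → rank x ℕ.< K ℕ.+ K
    rank<K+K {x} x<K with x ℕ.≤? i₀ | x ℕ.<? K
    ... | yes _ | _      = ℕ.+-monoʳ-< K x<K
    ... | no _  | yes _  = ℕ.<-≤-trans x<K (ℕ.m≤m+n K K)
    ... | no _  | no x≮K = contradiction x<K x≮K

    rank-rises : ∀ {x y} → x ≢ i₀ → IsArc x y → rank x ℕ.< rank y
    rank-rises {x} x≢i₀ (inj₁ (refl , 1+x<K)) with ℕ.<-cmp x i₀
    ... | tri< x<i₀ _ _ = subst₂ ℕ._<_ (sym (rank-≤i₀ (ℕ.<⇒≤ x<i₀))) (sym (rank-≤i₀ x<i₀))
                            (ℕ.+-monoʳ-< K (ℕ.n<1+n x))
    ... | tri≈ _ x≡i₀ _ = contradiction x≡i₀ x≢i₀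
    ... | tri> _ _ i₀<x = subst₂ ℕ._<_ (sym (rank->i₀ i₀<x (ℕ.<-trans (ℕ.n<1+n x) 1+x<K)))
                            (sym (rank->i₀ (ℕ.<-trans i₀<x (ℕ.n<1+n x)) 1+x<K)) (ℕ.n<1+n x)
    rank-rises N≢i₀ (inj₂ (inj₁ (refl , refl))) =
      subst₂ ℕ._<_ (sym (rank->i₀ i₀<N (ℕ.n<1+n N))) (sym (rank-≤i₀ ℕ.z≤n))
        (subst (N ℕ.<_) (sym (ℕ.+-identityʳ K)) (ℕ.n<1+n N))
      where i₀<N = ℕ.≤∧≢⇒< (ℕ.≤-pred i₀<K) (N≢i₀ ∘ sym)
    rank-rises {x} _ (inj₂ (inj₂ (x<K , refl))) =
      subst (rank x ℕ.<_) (sym rank-sink) (rank<K+K x<K)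

  acyclic-without-rim-vertex : ∀ {X : Vertex D → Set} i → ¬ X (rim i) → InducesAcyclic D X
  acyclic-without-rim-vertex {X} i rim-i∉X =
    acyclic-by-rank D (rank ∘ toℕ) λ {u} {w} u∈X _ u→w →
      rank-rises (≢i u∈X) (Arc⇒IsArc {u} {w} u→w)
    where
    open Rank (toℕ i) (Fin.toℕ<n i)
    ≢i : ∀ {v} → X v → toℕ v ≢ toℕ i
    ≢i v∈X v≡i = rim-i∉X (subst X (Fin.toℕ-injective (trans v≡i (sym (toℕ-rim i)))) v∈X)

  cycle-covers-rim : ∀ {X} → DirectedCycleIn D X → ∀ i → X (rim i)
  cycle-covers-rim {X} record { k = k ; f = f ; inj = inj ; inX = inX ; step = step ; close = close } i
    with Fin.any? (λ t → f t Fin.≟ rim i)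
  ... | yes (t , ft≡rim-i) = subst X ft≡rim-i (inX t)
  ... | no rim-i∉C = ⊥-elim (acyclic-without-rim-vertex {λ v → ∃ λ t → f t ≡ v} i rim-i∉C
          record { k = k ; f = f ; inj = inj ; inX = λ t → t , refl ; step = step ; close = close })

  two-colour : Vertex D → ℚ
  two-colour zero    = 0ℚ
  two-colour (suc _) = 1ℚ

  weak-circular-2-colourable : WeakCircularColourable D 2ℚ
  weak-circular-2-colourable =
    from-yes (1ℚ ≤? 2ℚ) , (two-colour , bounds) , (λ u w _ → arc-condition u w) , classes-acyclic
    where
    bounds : ∀ v → 0ℚ ≤ two-colour v × two-colour v < 2ℚ
    bounds zero    = ≤-refl , from-yes (0ℚ <? 2ℚ)
    bounds (suc _) = <⇒≤ 0<1 , from-yes (1ℚ <? 2ℚ)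
    arc-condition : ∀ u w → WeakArcCondition 2ℚ (two-colour u) (two-colour w)
    arc-condition zero    zero    = inj₁ refl
    arc-condition (suc _) (suc _) = inj₁ refl
    arc-condition zero    (suc _) = inj₂ (1ℚ , (<⇒≤ 0<1 , from-yes (1ℚ <? 2ℚ) , ℤ.+ 0 , refl) , ≤-refl)
    arc-condition (suc _) zero    = inj₂ (1ℚ , (<⇒≤ 0<1 , from-yes (1ℚ <? 2ℚ) , ℤ.-1ℤ , refl) , ≤-refl)
    classes-acyclic : ∀ t → InducesAcyclic D (λ v → two-colour v ≡ t)
    classes-acyclic t with t ≟ 0ℚ
    ... | yes refl = acyclic-without-rim-vertex (Fin.fromℕ N) λ ()
    ... | no t≢0   = acyclic-without-rim-vertex zero (t≢0 ∘ sym)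

  weak-circular⇒2≤p : ∀ {p} → WeakCircularColourable D p → 2ℚ ≤ p
  weak-circular⇒2≤p {p} (1≤p , (c , c-bounds) , arc-condition , classes-acyclic) = ≮⇒≥ p≮2
    where
    open Lead 1≤p (proj₁ (c-bounds sink)) (proj₂ (c-bounds sink))
    lead≤p-1 : ∀ i → lead (c (rim i)) ≤ p - 1ℚ
    lead≤p-1 i = weak-arc-to-s⇒lead≤p-1 (proj₁ (c-bounds (rim i))) (proj₂ (c-bounds (rim i)))
                   (arc-condition (rim i) sink (rim-to-sink i))
    p≮2 : ¬ p < 2ℚ
    p≮2 p<2 = classes-acyclic (c (rim zero)) (rim-cycle (λ i → sym (rim-monochromatic i)))
      where
      descent : ∀ {u w} → Arc D (rim u) (rim w) →
                c (rim u) ≡ c (rim w) ⊎ lead (c (rim w)) < lead (c (rim u))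
      descent {u} {w} u→w =
        weak-arc-lowers-lead p<2 (proj₁ (c-bounds (rim u))) (proj₂ (c-bounds (rim u)))
          (proj₁ (c-bounds (rim w))) (proj₂ (c-bounds (rim w))) (lead≤p-1 w)
          (arc-condition (rim u) (rim w) u→w)
      rim-monochromatic : ∀ i → c (rim zero) ≡ c (rim i)
      rim-monochromatic =
        cyclic-descent-is-constant (c ∘ rim) lead (descent ∘ rim-step) (descent rim-close)

  h : ℚ
  h = 1/suc j

  N*h≡1 : fromℤ (ℤ.+ N) * h ≡ 1ℚ
  N*h≡1 = suc*1/suc≡1 j

  -- Reducing mod K gives the sink the colour of rim vertex 0.
  spaced-colour : Vertex D → ℚ
  spaced-colour v = fromℤ (ℤ.+ (toℕ v ℕ.% K)) * h

  spaced-colour-rim : ∀ {i} (i<K : i ℕ.< K) →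
                      spaced-colour (rim (Fin.fromℕ< i<K)) ≡ fromℤ (ℤ.+ i) * h
  spaced-colour-rim {i} i<K = cong (λ x → fromℤ (ℤ.+ x) * h)
    (trans (cong (ℕ._% K) (trans (toℕ-rim (Fin.fromℕ< i<K)) (Fin.toℕ-fromℕ< i<K))) (ℕ.m<n⇒m%n≡m i<K))

  acyclic-colourable-1+h : AcyclicColourable D (1ℚ + h)
  acyclic-colourable-1+h = 1≤1+h , (spaced-colour , bounds) , no-cycle
    where
    instance _ = nonNegative (<⇒≤ (0<1/suc j))
    1≤1+h : 1ℚ ≤ 1ℚ + h
    1≤1+h = subst (_≤ 1ℚ + h) (+-identityʳ 1ℚ) (+-monoʳ-≤ 1ℚ (<⇒≤ (0<1/suc j)))
    bounds : ∀ v → 0ℚ ≤ spaced-colour v × spaced-colour v < 1ℚ + h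
    bounds v = nonNegative⁻¹ (spaced-colour v) {{nonNeg*nonNeg⇒nonNeg (fromℤ (ℤ.+ m)) {{0≤m}} h}}
             , ≤-<-trans (≤-trans (*-monoʳ-≤-nonNeg h m≤N) (≤-reflexive N*h≡1)) 1<1+h
      where
      m = toℕ v ℕ.% K
      0≤m = nonNegative (fromℤ-mono-≤ {0} {m} ℕ.z≤n)
      m≤N = fromℤ-mono-≤ {m} {N} (ℕ.≤-pred (ℕ.m%n<n (toℕ v) K))
      1<1+h = subst (_< 1ℚ + h) (+-identityʳ 1ℚ) (+-monoʳ-< 1ℚ (0<1/suc j))
    no-cycle : IsAcyclicColouring D (1ℚ + h) (spaced-colour , bounds)
    no-cycle a _ _ C = <-irrefl N*h≡1 $ progression-in-unit-arc⇒n*h<1 N (<⇒≤ (0<1/suc j)) ≤-refl λ i i≤N →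
      subst (InUnitIntervalFrom (1ℚ + h) a) (spaced-colour-rim (ℕ.s≤s i≤N))
        (cycle-covers-rim C (Fin.fromℕ< (ℕ.s≤s i≤N)))

  acyclic⇒1+h≤p : ∀ {p} → AcyclicColourable D p → 1ℚ + h ≤ p
  acyclic⇒1+h≤p {p} (1≤p , (c , c-bounds) , acyclic) = ≮⇒≥ λ p<1+h →
    let (θ , 0<θ , θ≤1 , K[θ+p-1]<p) = slack-below-1+1/suc j 1≤p p<1+h
    in  <-irrefl refl (<-≤-trans K[θ+p-1]<p
          (uncovered-points⇒p≤n*[θ+p-1] (c ∘ rim) 1≤p 0<θ θ≤1 (c-bounds ∘ rim) no-arc-covers-rim))
    where
    no-arc-covers-rim : ∀ a → 0ℚ ≤ a → a < p → ¬ (∀ i → InUnitIntervalFrom p a (c (rim i)))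
    no-arc-covers-rim a 0≤a a<p rim⊆arc = acyclic a 0≤a a<p (rim-cycle rim⊆arc)

mainTheorem13 : ∀ (ε : ℚ) → 0ℚ < ε →
    Σ Digraph λ D → ∃ λ (χc : ℚ) → ∃ λ (χs : ℚ) →
      CircularDichromatic D χc × DichromaticStar D χs × (1ℚ - ε ≤ χc - χs)
mainTheorem13 ε 0<ε =
  let (j , h≤ε) = 1/suc-below ε 0<ε
      open CycleWithSink j
  in  D , 2ℚ , 1ℚ + h
    , least-is-infimum weak-circular-2-colourable (λ _ → weak-circular⇒2≤p)
    , least-is-infimum acyclic-colourable-1+h (λ _ → acyclic⇒1+h≤p)
    , subst (1ℚ - ε ≤_) (1-h≡2-[1+h] h) (+-monoʳ-≤ 1ℚ (neg-antimono-≤ h≤ε))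
  where
  1-h≡2-[1+h] : ∀ h → 1ℚ - h ≡ 2ℚ - (1ℚ + h)
  1-h≡2-[1+h] = solve-∀ ℚ-ring
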